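{- Let $\mathcal S$ be a finite generalized quadrangle of order $(s,t)$ with flag set $\Omega$ and relations $R_0,\dots,R_7$ as in the context. For $x\in\Omega$ let $C_1(x)$ be the equivalence class of $x$ under the equivalence relation $R_0\cup R_1$. If $(x,y)\in R_6$, then $(w,z)\in R_6\cup R_7$ for every $(w,z)\in C_1(x)\times C_1(y)$.
   Context: A finite generalized quadrangle of order $(s,t)$ is an incidence structure $(\mathcal P,\mathcal L,\mathrm I)$ of points and lines in which each point is on $t+1$ lines, each line has $s+1$ points, two distinct points lie on at most one common line, two distinct lines share at most one point, and for every non-incident point $p$ and line $L$ there is a unique pair $(q,M)$ with $p\,\mathrm I\,M\,\mathrm I\,q\,\mathrm I\,L$. A flag is an incident pair $(p,L)$; $\Omega$ is the set of flags. $R_0$ is the diagonal of $\Omega$, and for flags $(p,L),(q,M)$: $R_1$: $p=q$, $L\ne M$; $R_2$: $L=M$, $p\ne q$; $R_3$: $p\ne q$ collinear on $L$, $M\ne L$; $R_4$: $p\neq q$ collinear on $M$, $L\neq M$; $R_5$: $p\ne q$ collinear on a line different from $L$ and $M$; $R_6$: $L\ne M$ meet in a point $r\ne p,q$; $R_7$: $L,M$ disjoint and $p,q$ not collinear. -}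

module Defs where

open import Data.Nat using (ℕ; suc)
open import Data.Fin using (Fin)
open import Data.Bool using (Bool; true)
open import Data.List using (List; filter; length)
open import Data.List.Base using (allFin)
open import Data.Product using (Σ; ∃; ∃-syntax; _×_; _,_; proj₁; proj₂)
open import Data.Sum using (_⊎_)
open import Relation.Nullary using (¬_)
open import Data.Empty using (⊥)
open import Relation.Binary.PropositionalEquality using (_≡_; _≢_)
open import Data.Bool using (_≟_)

count : {n : ℕ} → (Fin n → Bool) → ℕ
count {n} f = length (filter (λ i → f i ≟ true) (allFin n))

record GQ (s t : ℕ) : Set where
  field
    np nl : ℕ
    inc : Fin np → Fin nl → Bool

  I : Fin np → Fin nl → Set
  I p L = inc p L ≡ true

  field
    linesPerPoint : ∀ p → count (λ L → inc p L) ≡ suc t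
    pointsPerLine : ∀ L → count (λ p → inc p L) ≡ suc s
    pointsOneLine : ∀ p q L M → p ≢ q → I p L → I q L → I p M → I q M → L ≡ M
    linesOnePoint : ∀ L M p q → L ≢ M → I p L → I p M → I q L → I q M → p ≡ q
    axiomGQ : ∀ p L → ¬ I p L →
      Σ (Fin np × Fin nl) (λ qM → I p (proj₂ qM) × I (proj₁ qM) (proj₂ qM) × I (proj₁ qM) L
        × (∀ (q' : Fin np) (M' : Fin nl) → I p M' → I q' M' → I q' L → (q' , M') ≡ qM))

module Flags {s t : ℕ} (S : GQ s t) where
  open GQ S

  Flag : Set
  Flag = Σ (Fin np × Fin nl) (λ pL → I (proj₁ pL) (proj₂ pL))

  pt : Flag → Fin np
  pt x = proj₁ (proj₁ x)

  ln : Flag → Fin nl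
  ln x = proj₂ (proj₁ x)

  Collinear : Fin np → Fin np → Set
  Collinear p q = ∃[ N ] (I p N × I q N)

  R0 R1 R6 R7 : Flag → Flag → Set
  R0 x y = x ≡ y
  R1 x y = pt x ≡ pt y × ln x ≢ ln y
  R6 x y = ln x ≢ ln y × (∃[ r ] (I r (ln x) × I r (ln y) × r ≢ pt x × r ≢ pt y))
  R7 x y = (∀ r → I r (ln x) → I r (ln y) → ⊥) × ¬ Collinear (pt x) (pt y)

  C1 : Flag → Flag → Set
  C1 x w = R0 x w ⊎ R1 x w

{-# OPTIONS --safe #-}
-- Flags in the same C₁-class share their point, so only the points of w and z
-- matter.  The points of an R₆-pair are not collinear: otherwise the point q
-- of y would have two projections onto the line L of x, namely the point p of x
-- and the intersection r of the two lines.  Finally, two flags with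
-- non-collinear points are in R₆ or R₇ according to whether their lines meet.
module Submission where

open import Defs
open import Data.Nat using (ℕ)
open import Data.Fin.Properties using (any?)
open import Data.Bool using (true) renaming (_≟_ to _≟ᵇ_)
open import Data.Sum using (_⊎_; inj₁; inj₂)
open import Data.Product using (∃-syntax; _×_; _,_; proj₁)
open import Relation.Nullary using (Dec; yes; no; ¬_)
open import Relation.Nullary.Decidable using (_×-dec_)
open import Relation.Binary.PropositionalEquality using (_≡_; _≢_; sym; trans; cong; subst; subst₂)

module _ {s t : ℕ} (S : GQ s t) where
  open GQ S
  open Flags S

  projection-unique : ∀ {p L} → ¬ I p L → ∀ {q q′ M M′} →
                      I p M → I q M → I q L → I p M′ → I q′ M′ → I q′ L → q ≡ q′
  projection-unique {p} {L} p∉L pM qM qL pM′ q′M′ q′L =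
    let (_ , _ , _ , _ , unique) = axiomGQ p L p∉L
    in cong proj₁ (trans (unique _ _ pM qM qL) (sym (unique _ _ pM′ q′M′ q′L)))

  R6⇒¬Collinear : ∀ x y → R6 x y → ¬ Collinear (pt x) (pt y)
  R6⇒¬Collinear ((p , L) , pL) ((q , M) , qM) (L≢M , r , rL , rM , r≢p , r≢q) (N , pN , qN) =
    r≢p (projection-unique q∉L qM rM rL qN pN pL)
    where
    q∉L : ¬ I q L
    q∉L qL = r≢q (linesOnePoint L M r q L≢M rL rM qL qM)

  meet? : ∀ L M → Dec (∃[ r ] (I r L × I r M))
  meet? L M = any? (λ r → (inc r L ≟ᵇ true) ×-dec (inc r M ≟ᵇ true))

  ¬Collinear⇒R6⊎R7 : ∀ w z → ¬ Collinear (pt w) (pt z) → R6 w z ⊎ R7 w z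
  ¬Collinear⇒R6⊎R7 ((p , L) , pL) ((q , M) , qM) p≁q with meet? L M
  ... | yes (r , rL , rM) = inj₁ (L≢M , r , rL , rM , r≢p , r≢q)
    where
    L≢M : L ≢ M
    L≢M L≡M = p≁q (M , subst (I p) L≡M pL , qM)
    r≢p : r ≢ p
    r≢p r≡p = p≁q (M , subst (λ v → I v M) r≡p rM , qM)
    r≢q : r ≢ q
    r≢q r≡q = p≁q (L , pL , subst (λ v → I v L) r≡q rL)
  ... | no ¬meet = inj₂ ((λ r rL rM → ¬meet (r , rL , rM)) , p≁q)

  C1⇒pt≡ : ∀ {x w} → C1 x w → pt x ≡ pt w
  C1⇒pt≡ (inj₁ x≡w)       = cong pt x≡w
  C1⇒pt≡ (inj₂ (p≡ , _)) = p≡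

mainTheorem4 : {s t : ℕ} (S : GQ s t) → let open Flags S in
    (x y : Flag) → R6 x y →
    (w z : Flag) → C1 x w → C1 y z → R6 w z ⊎ R7 w z
mainTheorem4 S x y xR6y w z xC1w yC1z =
  ¬Collinear⇒R6⊎R7 S w z
    (subst₂ (λ p q → ¬ Flags.Collinear S p q) (C1⇒pt≡ S xC1w) (C1⇒pt≡ S yC1z)
      (R6⇒¬Collinear S x y xR6y))
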